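{- Let $3 \le k \le s$ be integers and let $A$ and $B$ be disjoint vertex sets. Let $H^k_0(A,B)$ be the $k$-graph on $A \cup B$ whose edges are exactly the $k$-subsets $e$ of $A\cup B$ with $|e \cap A| \not\equiv k \pmod 2$. Suppose that $H^k_0(A,B)$ contains a tight cycle $C$ on $s$ vertices with $V(C) \cap A \neq \emptyset$, and let $d = \gcd(k,s)$. Then $|V(C)\cap A| \equiv 0 \pmod{s/d}$, and $(k,s)$ is not an admissible pair, i.e. $d \ne 1$ and $k/d$ is odd.
   Context: A tight cycle on $s$ vertices in a $k$-graph is a subhypergraph on $s$ vertices with a cyclic ordering $v_1,\dots,v_s$ of its vertices such that every $k$ cyclically consecutive vertices form an edge. The pair $(k,s)$ is called admissible if $\gcd(k,s)=1$ or $k/\gcd(k,s)$ is even. -}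

module Defs where

open import Data.Nat using (ℕ; zero; suc; _+_; NonZero; ≢-nonZero)
open import Data.Nat.DivMod using (_/_; _%_; _mod_)
open import Data.Nat.GCD using (gcd; gcd[m,n]≢0)
open import Data.Nat.Divisibility using (_∣_)
open import Data.Fin using (Fin; toℕ)
open import Data.Sum using (_⊎_; inj₁; inj₂)
open import Data.List using (List; map; upTo; length; allFin)
open import Data.Nat.ListAction using (sum)
open import Data.List.Relation.Unary.Unique.Propositional using (Unique)
open import Data.Product using (_×_)
open import Relation.Binary.PropositionalEquality using (_≡_)
open import Relation.Nullary using (¬_)
open import Function.Definitions using (Injective)

-- The vertex set A ∪ B of two disjoint sets A, B is modelled as A ⊎ B.
-- A finite set of vertices is modelled as a duplicate-free list.

module _ {A B : Set} where

  inA : A ⊎ B → ℕ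
  inA (inj₁ _) = 1
  inA (inj₂ _) = 0

  countA : List (A ⊎ B) → ℕ
  countA e = sum (map inA e)

  H0Edge : ℕ → List (A ⊎ B) → Set
  H0Edge k e = Unique e × length e ≡ k × ¬ (countA e % 2 ≡ k % 2)

window : {V : Set} (s : ℕ) .{{_ : NonZero s}} → (Fin s → V) → Fin s → ℕ → List V
window s v i k = map (λ j → v ((toℕ i + j) mod s)) (upTo k)

record TightCycle {V : Set} (k s : ℕ) .{{_ : NonZero s}} (E : List V → Set) : Set where
  field
    vert     : Fin s → V
    distinct : Injective _≡_ _≡_ vert
    edges    : ∀ i → E (window s vert i k)

open TightCycle public

gcd-nonZeroˡ : ∀ k s .{{_ : NonZero k}} → NonZero (gcd k s)
gcd-nonZeroˡ (suc k) s = ≢-nonZero (gcd[m,n]≢0 (suc k) s (inj₁ λ ()))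

gcd-nonZeroʳ : ∀ k s .{{_ : NonZero s}} → NonZero (gcd k s)
gcd-nonZeroʳ k (suc s) = ≢-nonZero (gcd[m,n]≢0 k (suc s) (inj₂ λ ()))

Admissible : (k s : ℕ) .{{_ : NonZero k}} → Set
Admissible k s = gcd k s ≡ 1 ⊎ (2 ∣ _/_ k (gcd k s) {{gcd-nonZeroˡ k s}})

s/gcd : (k s : ℕ) .{{_ : NonZero s}} → ℕ
s/gcd k s = _/_ s (gcd k s) {{gcd-nonZeroʳ k s}}

cycleCountA : {A B : Set} {k s : ℕ} .{{_ : NonZero s}} {E : List (A ⊎ B) → Set} →
              TightCycle k s E → ℕ
cycleCountA {s = s} C = countA (map (vert C) (allFin s))

-- Let x_j ∈ {0,1} record whether the j-th vertex of the cycle (index read mod s) lies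
-- in A, and let W_i = x_i + ⋯ + x_{i+k-1} count the A-vertices of the i-th window.
-- Every window is an edge, so all W_i have the parity opposite to k, hence the same
-- parity; as W_{i+1} − W_i = x_{i+k} − x_i is a difference of bits, x_{i+k} = x_i.
-- So x has the periods k and s, hence the period d = gcd(k,s), and with
-- P = x_0 + ⋯ + x_{d-1} we get |V(C) ∩ A| = (s/d)·P and W_0 = (k/d)·P.
-- If k/d is even, W_0 and k are both even; if d = 1, x is constant and equal to 1
-- because C meets A, so W_0 = k. Either way W_0 ≡ k (mod 2), a contradiction.
module Submission where

open import Defs
open import Data.Nat using (ℕ; zero; suc; _+_; _*_; _≤_; z≤n; s≤s; s≤s⁻¹; NonZero)
open import Data.Nat.Properties
  using (+-assoc; +-comm; +-suc; +-identityʳ; n≤1⇒n≡0∨n≡1)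
open import Data.Nat.DivMod
  using (_/_; _%_; _mod_; m%n<n; m%n%n≡m%n; [m+n]%n≡m%n; %-distribˡ-+; m<n⇒m%n≡m; m/n*n≡m)
open import Data.Nat.Divisibility using (_∣_; m∣m*n; ∣m⇒∣m*n; n∣m⇒m%n≡0)
open import Data.Nat.GCD using (gcd; gcd-GCD; gcd[m,n]∣m; gcd[m,n]∣n; module Bézout)
open import Data.Nat.ListAction using (sum)
open import Data.Nat.ListAction.Properties using (sum-++)
open import Data.Fin using (Fin; toℕ)
open import Data.Fin.Properties using (fromℕ<-cong; fromℕ<-toℕ; toℕ<n; toℕ-fromℕ<)
open import Data.List using ([_]; _∷_; _++_; map; applyUpTo; upTo; tabulate)
open import Data.List.Properties using (applyUpTo-∷ʳ; map-upTo; map-∘; map-tabulate; tabulate-cong)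
open import Data.Sum using (_⊎_; inj₁; inj₂)
open import Data.Product using (_×_; ∃; _,_; proj₂)
open import Data.Empty using (⊥-elim)
open import Function using (_∘_)
open import Relation.Binary.PropositionalEquality using (_≡_; refl; sym; trans; cong; cong₂; subst; module ≡-Reasoning)
open import Relation.Nullary using (¬_)

sumUpTo : ℕ → (ℕ → ℕ) → ℕ
sumUpTo n h = sum (applyUpTo h n)

sumUpTo-cong : ∀ n {g h : ℕ → ℕ} → (∀ j → g j ≡ h j) → sumUpTo n g ≡ sumUpTo n h
sumUpTo-cong zero    g≗h = refl
sumUpTo-cong (suc n) g≗h = cong₂ _+_ (g≗h 0) (sumUpTo-cong n (g≗h ∘ suc))

sumUpTo-suc : ∀ n h → sumUpTo (suc n) h ≡ sumUpTo n h + h n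
sumUpTo-suc n h = begin
  sum (applyUpTo h (suc n))          ≡⟨ cong sum (applyUpTo-∷ʳ h n) ⟨
  sum (applyUpTo h n ++ [ h n ])     ≡⟨ sum-++ (applyUpTo h n) [ h n ] ⟩
  sumUpTo n h + (h n + 0)            ≡⟨ cong (sumUpTo n h +_) (+-identityʳ (h n)) ⟩
  sumUpTo n h + h n                  ∎
  where open ≡-Reasoning

sumUpTo-+ : ∀ m n h → sumUpTo (m + n) h ≡ sumUpTo m h + sumUpTo n (λ j → h (m + j))
sumUpTo-+ zero    n h = refl
sumUpTo-+ (suc m) n h = trans (cong (h 0 +_) (sumUpTo-+ m n (h ∘ suc)))
                              (sym (+-assoc (h 0) _ _))

tabulate-∘toℕ : ∀ {a} {X : Set a} n (h : ℕ → X) → tabulate {n = n} (h ∘ toℕ) ≡ applyUpTo h n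
tabulate-∘toℕ zero    h = refl
tabulate-∘toℕ (suc n) h = cong (h 0 ∷_) (tabulate-∘toℕ n (h ∘ suc))

Periodic : ∀ {a} {X : Set a} → ℕ → (ℕ → X) → Set a
Periodic p f = ∀ i → f (i + p) ≡ f i

module _ {a} {X : Set a} {f : ℕ → X} where

  periodic-* : ∀ {p} → Periodic p f → ∀ q → Periodic (q * p) f
  periodic-* per zero    i = cong f (+-identityʳ i)
  periodic-* {p} per (suc q) i = begin
    f (i + (p + q * p)) ≡⟨ cong f (+-assoc i p (q * p)) ⟨
    f (i + p + q * p)   ≡⟨ periodic-* per q (i + p) ⟩
    f (i + p)           ≡⟨ per i ⟩
    f i                 ∎
    where open ≡-Reasoning

  periodic-∸ : ∀ {d m n} → Periodic m f → Periodic n f → d + m ≡ n → Periodic d f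
  periodic-∸ {d} {m} {n} per-m per-n d+m≡n i = begin
    f (i + d)     ≡⟨ per-m (i + d) ⟨
    f (i + d + m) ≡⟨ cong f (trans (+-assoc i d m) (cong (i +_) d+m≡n)) ⟩
    f (i + n)     ≡⟨ per-n i ⟩
    f i           ∎
    where open ≡-Reasoning

  periodic-gcd : ∀ {m n} → Periodic m f → Periodic n f → Periodic (gcd m n) f
  periodic-gcd {m} {n} per-m per-n with Bézout.identity (gcd-GCD m n)
  ... | Bézout.+- x y eq = periodic-∸ (periodic-* per-n y) (periodic-* per-m x) eq
  ... | Bézout.-+ x y eq = periodic-∸ (periodic-* per-m x) (periodic-* per-n y) eq

  periodic-1⇒constant : Periodic 1 f → ∀ i → f i ≡ f 0
  periodic-1⇒constant per zero    = refl
  periodic-1⇒constant per (suc i) =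
    trans (cong f (+-comm 1 i)) (trans (per i) (periodic-1⇒constant per i))

sumUpTo-periodic : ∀ {p h} → Periodic p h → ∀ q → sumUpTo (q * p) h ≡ q * sumUpTo p h
sumUpTo-periodic             per zero    = refl
sumUpTo-periodic {p} {h} per (suc q) = begin
  sumUpTo (p + q * p) h                             ≡⟨ sumUpTo-+ p (q * p) h ⟩
  sumUpTo p h + sumUpTo (q * p) (λ j → h (p + j))   ≡⟨ cong (sumUpTo p h +_) (sumUpTo-cong (q * p) shift) ⟩
  sumUpTo p h + sumUpTo (q * p) h                   ≡⟨ cong (sumUpTo p h +_) (sumUpTo-periodic per q) ⟩
  sumUpTo p h + q * sumUpTo p h                     ∎
  where
  open ≡-Reasoning
  shift : ∀ j → h (p + j) ≡ h j
  shift j = trans (cong h (+-comm p j)) (per j)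

%2≡0∨%2≡1 : ∀ m → m % 2 ≡ 0 ⊎ m % 2 ≡ 1
%2≡0∨%2≡1 m = n≤1⇒n≡0∨n≡1 (s≤s⁻¹ (m%n<n m 2))

m%2≢o%2⇒n%2≢o%2⇒m%2≡n%2 : ∀ m n o → ¬ m % 2 ≡ o % 2 → ¬ n % 2 ≡ o % 2 → m % 2 ≡ n % 2
m%2≢o%2⇒n%2≢o%2⇒m%2≡n%2 m n o m≢o n≢o
  with %2≡0∨%2≡1 m | %2≡0∨%2≡1 n | %2≡0∨%2≡1 o
... | inj₁ m0 | inj₁ n0 | _       = trans m0 (sym n0)
... | inj₂ m1 | inj₂ n1 | _       = trans m1 (sym n1)
... | inj₁ m0 | inj₂ _  | inj₁ o0 = ⊥-elim (m≢o (trans m0 (sym o0)))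
... | inj₂ m1 | inj₁ _  | inj₂ o1 = ⊥-elim (m≢o (trans m1 (sym o1)))
... | inj₁ _  | inj₂ n1 | inj₂ o1 = ⊥-elim (n≢o (trans n1 (sym o1)))
... | inj₂ _  | inj₁ n0 | inj₁ o0 = ⊥-elim (n≢o (trans n0 (sym o0)))

[1+n]%2≢n%2 : ∀ n → ¬ suc n % 2 ≡ n % 2
[1+n]%2≢n%2 zero          ()
[1+n]%2≢n%2 (suc zero)    ()
[1+n]%2≢n%2 (suc (suc n)) = [1+n]%2≢n%2 n

bits-≡-by-parity : ∀ {x y u v} → x ≤ 1 → y ≤ 1 → x + v ≡ u + y → u % 2 ≡ v % 2 → x ≡ y
bits-≡-by-parity z≤n       z≤n       _   _   = refl
bits-≡-by-parity (s≤s z≤n) (s≤s z≤n) _   _   = refl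
bits-≡-by-parity {u = u} z≤n (s≤s z≤n) v≡u+1 u≡v =
  ⊥-elim ([1+n]%2≢n%2 u (trans (cong (_% 2) (trans (+-comm 1 u) (sym v≡u+1))) (sym u≡v)))
bits-≡-by-parity {v = v} (s≤s z≤n) z≤n 1+v≡u u≡v =
  ⊥-elim ([1+n]%2≢n%2 v (trans (cong (_% 2) (trans 1+v≡u (+-identityʳ _))) u≡v))

module _ {n : ℕ} .{{_ : NonZero n}} where

  %-≡⇒mod-≡ : ∀ {i j} → i % n ≡ j % n → i mod n ≡ j mod n
  %-≡⇒mod-≡ {i} {j} eq = fromℕ<-cong (i % n) (j % n) eq (m%n<n i n) (m%n<n j n)

  toℕ-mod : ∀ (i : Fin n) → toℕ i mod n ≡ i
  toℕ-mod i = trans (fromℕ<-cong _ _ (m<n⇒m%n≡m (toℕ<n i)) (m%n<n (toℕ i) n) (toℕ<n i))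
                    (fromℕ<-toℕ i (toℕ<n i))

  [m%n+o]%n≡[m+o]%n : ∀ m o → (m % n + o) % n ≡ (m + o) % n
  [m%n+o]%n≡[m+o]%n m o = begin
    (m % n + o) % n         ≡⟨ %-distribˡ-+ (m % n) o n ⟩
    (m % n % n + o % n) % n ≡⟨ cong (λ r → (r + o % n) % n) (m%n%n≡m%n m n) ⟩
    (m % n + o % n) % n     ≡⟨ %-distribˡ-+ m o n ⟨
    (m + o) % n             ∎
    where open ≡-Reasoning

inA≤1 : ∀ {A B : Set} (v : A ⊎ B) → inA v ≤ 1
inA≤1 (inj₁ _) = s≤s z≤n
inA≤1 (inj₂ _) = z≤n

module _ {A B : Set} {k s : ℕ} .{{_ : NonZero k}} .{{_ : NonZero s}}
         (C : TightCycle {A ⊎ B} k s (H0Edge k)) where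

  -- The same instance as in Admissible, so that k / gcd k s unifies with its divisor term.
  private instance
    gcd≢0 : NonZero (gcd k s)
    gcd≢0 = gcd-nonZeroˡ k s

  inA-at : ℕ → ℕ
  inA-at j = inA (vert C (j mod s))

  windowCountA : ℕ → ℕ
  windowCountA i = sumUpTo k (λ j → inA-at (i + j))

  inA-at-cong : ∀ {i j} → i % s ≡ j % s → inA-at i ≡ inA-at j
  inA-at-cong = cong (inA ∘ vert C) ∘ %-≡⇒mod-≡

  inA-at-toℕ : ∀ i → inA-at (toℕ i) ≡ inA (vert C i)
  inA-at-toℕ i = cong (inA ∘ vert C) (toℕ-mod i)

  inA-at-periodic-s : Periodic s inA-at
  inA-at-periodic-s i = inA-at-cong ([m+n]%n≡m%n i s)

  countA-window : ∀ i → countA (window s (vert C) (i mod s) k) ≡ windowCountA i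
  countA-window i = begin
    sum (map inA (map vertexAt (upTo k))) ≡⟨ cong sum (map-∘ (upTo k)) ⟨
    sum (map (inA ∘ vertexAt) (upTo k))   ≡⟨ cong sum (map-upTo (inA ∘ vertexAt) k) ⟩
    sumUpTo k (inA ∘ vertexAt)            ≡⟨ sumUpTo-cong k (λ j → inA-at-cong (reduce j)) ⟩
    windowCountA i                        ∎
    where
    open ≡-Reasoning
    vertexAt : ℕ → A ⊎ B
    vertexAt j = vert C ((toℕ (i mod s) + j) mod s)
    reduce : ∀ j → (toℕ (i mod s) + j) % s ≡ (i + j) % s
    reduce j = trans (cong (λ r → (r + j) % s) (toℕ-fromℕ< (m%n<n i s))) ([m%n+o]%n≡[m+o]%n i j)

  windowCountA-parity : ∀ i → ¬ windowCountA i % 2 ≡ k % 2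
  windowCountA-parity i = proj₂ (proj₂ (edges C (i mod s))) ∘ trans (cong (_% 2) (countA-window i))

  windowCountA-suc : ∀ i → inA-at i + windowCountA (suc i) ≡ windowCountA i + inA-at (i + k)
  windowCountA-suc i = begin
    inA-at i + windowCountA (suc i)         ≡⟨ cong₂ _+_ (cong inA-at (+-identityʳ i))
                                                          (sumUpTo-cong k (λ j → cong inA-at (+-suc i j))) ⟨
    sumUpTo (suc k) (λ j → inA-at (i + j))  ≡⟨ sumUpTo-suc k (λ j → inA-at (i + j)) ⟩
    windowCountA i + inA-at (i + k)         ∎
    where open ≡-Reasoning

  inA-at-periodic-k : Periodic k inA-at
  inA-at-periodic-k i = sym (bits-≡-by-parity (inA≤1 _) (inA≤1 _) (windowCountA-suc i)
    (m%2≢o%2⇒n%2≢o%2⇒m%2≡n%2 (windowCountA i) (windowCountA (suc i)) k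
      (windowCountA-parity i) (windowCountA-parity (suc i))))

  inA-at-periodic-gcd : Periodic (gcd k s) inA-at
  inA-at-periodic-gcd = periodic-gcd inA-at-periodic-k inA-at-periodic-s

  cycleCountA≡ : cycleCountA C ≡ s / gcd k s * sumUpTo (gcd k s) inA-at
  cycleCountA≡ = begin
    sum (map inA (map (vert C) (tabulate (λ i → i)))) ≡⟨ cong (sum ∘ map inA) (map-tabulate (λ i → i) (vert C)) ⟩
    sum (map inA (tabulate (vert C)))                 ≡⟨ cong sum (map-tabulate (vert C) inA) ⟩
    sum (tabulate (inA ∘ vert C))                     ≡⟨ cong sum (tabulate-cong (sym ∘ inA-at-toℕ)) ⟩
    sum (tabulate {n = s} (inA-at ∘ toℕ))             ≡⟨ cong sum (tabulate-∘toℕ s inA-at) ⟩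
    sumUpTo s inA-at                                  ≡⟨ cong (λ n → sumUpTo n inA-at) (m/n*n≡m (gcd[m,n]∣n k s)) ⟨
    sumUpTo (s / gcd k s * gcd k s) inA-at            ≡⟨ sumUpTo-periodic inA-at-periodic-gcd (s / gcd k s) ⟩
    s / gcd k s * sumUpTo (gcd k s) inA-at            ∎
    where open ≡-Reasoning

  windowCountA-0 : windowCountA 0 ≡ k / gcd k s * sumUpTo (gcd k s) inA-at
  windowCountA-0 = trans (cong (λ n → sumUpTo n inA-at) (sym (m/n*n≡m (gcd[m,n]∣m k s))))
                         (sumUpTo-periodic inA-at-periodic-gcd (k / gcd k s))

  admissible⇒windowCountA-0-parity : (∃ λ i → ∃ λ (a : A) → vert C i ≡ inj₁ a) →
                                     Admissible k s → windowCountA 0 % 2 ≡ k % 2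
  admissible⇒windowCountA-0-parity (i , a , vᵢ≡a) (inj₁ d≡1) = cong (_% 2) (begin
    windowCountA 0                         ≡⟨ windowCountA-0 ⟩
    k / gcd k s * sumUpTo (gcd k s) inA-at ≡⟨ cong (k / gcd k s *_) P≡d ⟩
    k / gcd k s * gcd k s                  ≡⟨ m/n*n≡m (gcd[m,n]∣m k s) ⟩
    k                                      ∎)
    where
    open ≡-Reasoning
    P≡d : sumUpTo (gcd k s) inA-at ≡ gcd k s
    P≡d rewrite d≡1 = begin
      inA-at 0 + 0        ≡⟨ +-identityʳ _ ⟩
      inA-at 0            ≡⟨ periodic-1⇒constant (subst (λ d → Periodic d inA-at) d≡1 inA-at-periodic-gcd) (toℕ i) ⟨
      inA-at (toℕ i)      ≡⟨ inA-at-toℕ i ⟩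
      inA (vert C i)      ≡⟨ cong inA vᵢ≡a ⟩
      1                   ∎
  admissible⇒windowCountA-0-parity _ (inj₂ 2∣k/d) = trans
    (n∣m⇒m%n≡0 _ 2 (subst (2 ∣_) (sym windowCountA-0) (∣m⇒∣m*n _ 2∣k/d)))
    (sym (n∣m⇒m%n≡0 k 2 (subst (2 ∣_) (m/n*n≡m (gcd[m,n]∣m k s)) (∣m⇒∣m*n (gcd k s) 2∣k/d))))

proposition3p1 : (A B : Set) (k s : ℕ) → 3 ≤ k → k ≤ s →
    .{{_ : NonZero k}} → .{{_ : NonZero s}} →
    (C : TightCycle {A ⊎ B} k s (H0Edge k)) →
    (∃ λ i → ∃ λ (a : A) → vert C i ≡ inj₁ a) →
    (s/gcd k s ∣ cycleCountA C) × ¬ Admissible k s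
proposition3p1 A B k s _ _ C meetsA =
    subst (s/gcd k s ∣_) (sym (cycleCountA≡ C)) (m∣m*n _)
  , windowCountA-parity C 0 ∘ admissible⇒windowCountA-0-parity C meetsA
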